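{- Let $D$ be a finite simply-laced tree, let $i$ be a vertex of degree $d$, and let $a$ be a labeling such that exactly $m$ (with $0\le m\le d$) neighbors of $i$ are labeled $1$. If $m$ is even, then $T_i$ does not change the number of components of $a$. If $m$ is odd, then $T_i$ changes the number of components by $\pm(m-1)$. In particular $T_i$ preserves the parity of the number of components.
   Context: Reeder's puzzle on a finite connected simple graph: a labeling assigns $a_j\in\mathbb{Z}/2\mathbb{Z}$ to each vertex $j$; the move $T_i$ replaces $a_i$ by $a_i+\sum_k a_k \pmod 2$ (sum over the neighbors $k$ of $i$) and leaves all other labels unchanged. The components of a labeling are the connected components of the subgraph induced on vertices labeled $1$. -}

module Defs where

open import Data.Nat using (ℕ; zero; suc; _+_; _≤_; _%_)
open import Data.Bool using (Bool; true; false; _xor_; _∧_; if_then_else_)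
open import Data.Fin using (Fin; _≟_)
open import Data.List using (List; []; _∷_; _++_; [_]; length; map; foldr; allFin)
open import Data.Nat.ListAction using (sum)
open import Data.List.Relation.Unary.Linked using (Linked)
open import Data.List.Relation.Unary.Unique.Propositional using (Unique)
open import Data.Product using (Σ; _×_)
open import Data.Empty using (⊥)
open import Relation.Nullary using (¬_; does)
open import Relation.Binary.PropositionalEquality using (_≡_)

-- A finite simple (simply-laced) graph on the vertex set Fin n:
-- symmetric, irreflexive Bool-valued adjacency (no multiple edges, no loops).
record SimpleGraph (n : ℕ) : Set where
  field
    adj     : Fin n → Fin n → Bool
    adj-sym : ∀ u v → adj u v ≡ adj v u
    irrefl  : ∀ u → adj u u ≡ false
open SimpleGraph public

Adj : ∀ {n} → SimpleGraph n → Fin n → Fin n → Set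
Adj G u v = adj G u v ≡ true

-- Labelings with values in ℤ/2ℤ, represented by Bool (true = 1, xor = +).
Labeling : ℕ → Set
Labeling n = Fin n → Bool

-- Reach G S u v : there is a walk u = w₀, w₁, …, w_k = v in G whose
-- vertices after the first all satisfy S (for u with S u, a walk inside
-- the subgraph induced on S).
data Reach {n} (G : SimpleGraph n) (S : Fin n → Bool) : Fin n → Fin n → Set where
  here : ∀ {u} → Reach G S u u
  step : ∀ {u v w} → Reach G S u v → Adj G v w → S w ≡ true → Reach G S u w

allTrue : ∀ {n} → Fin n → Bool
allTrue _ = true

Connected : ∀ {n} → SimpleGraph n → Set
Connected {n} G = ∀ (u v : Fin n) → Reach G allTrue u v

-- A cycle: a list of k ≥ 3 pairwise distinct vertices v₀ … v_{k-1},
-- consecutive ones adjacent and v_{k-1} adjacent to v₀.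
IsCycle : ∀ {n} → SimpleGraph n → List (Fin n) → Set
IsCycle G [] = ⊥
IsCycle G (v ∷ vs) =
  (2 ≤ length vs) × Unique (v ∷ vs) × Linked (Adj G) ((v ∷ vs) ++ [ v ])

Acyclic : ∀ {n} → SimpleGraph n → Set
Acyclic G = ∀ vs → ¬ IsCycle G vs

IsTree : ∀ {n} → SimpleGraph n → Set
IsTree G = Connected G × Acyclic G

neighbourSum : ∀ {n} → SimpleGraph n → Labeling n → Fin n → Bool
neighbourSum G a i = foldr _xor_ false (map (λ k → adj G i k ∧ a k) (allFin _))

T : ∀ {n} → SimpleGraph n → Fin n → Labeling n → Labeling n
T G i a j = if does (j ≟ i) then a i xor neighbourSum G a i else a j

numOnesNbrs : ∀ {n} → SimpleGraph n → Labeling n → Fin n → ℕ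
numOnesNbrs G a i =
  sum (map (λ k → if adj G i k ∧ a k then 1 else 0) (allFin _))

Ones : ∀ {n} → Labeling n → Set
Ones {n} a = Σ (Fin n) (λ v → a v ≡ true)

-- HasComponents G a c : the subgraph of G induced on the vertices labeled 1
-- has exactly c connected components, witnessed by a surjective map from
-- those vertices onto Fin c whose fibres are exactly the components.
record HasComponents {n} (G : SimpleGraph n) (a : Labeling n) (c : ℕ) : Set where
  field
    comp       : Ones a → Fin c
    surjective : ∀ (k : Fin c) → Σ (Ones a) (λ x → comp x ≡ k)
    sameComp→  : ∀ (x y : Ones a) → comp x ≡ comp y → Reach G a (Σ.proj₁ x) (Σ.proj₁ y)
    sameComp←  : ∀ (x y : Ones a) → Reach G a (Σ.proj₁ x) (Σ.proj₁ y) → comp x ≡ comp y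

-- If i is added to the set of vertices labelled 1, the components of that set not touching i
-- survive, while the m components containing the labelled neighbours of i merge with i into
-- one; in a forest these m components are distinct, because two neighbours of i joined by a
-- path avoiding i would close a cycle. So switching a label at i changes the number of
-- components by m − 1; the two inequalities come from injections between Fin cb ⊎ Fin m and
-- Fin (1 + ca), where cb and ca count components with and without i. The move T_i switches
-- a_i exactly when m is odd.
module Submission where

open import Defs
open import Data.Nat using (ℕ; suc; _+_; _∸_; _%_; _/_; _*_; _≤_; z≤n; s≤s)
open import Data.Nat.Properties using (≤-antisym; +-suc; suc-injective)
open import Data.Nat.DivMod using (m%n<n; m≡m%n+[m/n]*n; [m+kn]%n≡m%n; %-distribˡ-+)
open import Data.Nat.ListAction using (sum)
open import Data.Bool using (Bool; true; false; not; _xor_; _∧_; if_then_else_) renaming (T to IsTrue)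
import Data.Bool.Properties as Bool
open import Data.Bool.Properties using (¬-not; xor-identityʳ; xor-comm; true-xor; T-≡; T-∧)
open import Data.Fin using (Fin; zero; suc; _≟_; splitAt; join)
open import Data.Fin.Properties using (injective⇒≤; splitAt-join; join-splitAt)
import Data.Fin.Properties as Fin
open import Data.List using (List; []; _∷_; _++_; [_]; length; map; foldr; allFin; lookup; filterᵇ)
open import Data.List.Properties using (map-cong)
open import Data.List.Relation.Unary.Any using (here; there; any?; index)
open import Data.List.Relation.Unary.Any.Properties using (lookup-index)
open import Data.List.Relation.Unary.All as All using (All; []; _∷_)
open import Data.List.Relation.Unary.All.Properties using (¬Any⇒All¬; all-filter)
open import Data.List.Relation.Unary.AllPairs using ([]; _∷_)
open import Data.List.Relation.Unary.Linked using (Linked; [-]; _∷_)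
open import Data.List.Relation.Unary.Unique.Propositional using (Unique)
open import Data.List.Relation.Unary.Unique.Propositional.Properties using (allFin⁺; filter⁺)
open import Data.List.Membership.Propositional using (_∈_)
open import Data.List.Membership.Propositional.Properties using (∈-allFin; ∈-filter⁺; ∈-lookup)
open import Data.Sum using (_⊎_; inj₁; inj₂)
open import Data.Sum.Properties using (inj₁-injective; inj₂-injective)
open import Data.Product using (Σ; _×_; _,_; proj₁; proj₂)
open import Data.Empty using (⊥; ⊥-elim)
open import Function using (_∘_; Injective; Equivalence)
open import Relation.Nullary using (Dec; yes; no; contradiction)
open import Relation.Nullary.Decidable using (T?)
open import Relation.Binary.PropositionalEquality hiding ([_])

open Equivalence using (to; from)

count-filterᵇ : ∀ {A : Set} (f : A → Bool) xs →
  sum (map (λ x → if f x then 1 else 0) xs) ≡ length (filterᵇ f xs)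
count-filterᵇ f [] = refl
count-filterᵇ f (x ∷ xs) with f x
... | true  = cong suc (count-filterᵇ f xs)
... | false = count-filterᵇ f xs

count-parity : ∀ {A : Set} (f : A → Bool) xs →
  sum (map (λ x → if f x then 1 else 0) xs) % 2 ≡ (if foldr _xor_ false (map f xs) then 1 else 0)
count-parity f [] = refl
count-parity f (x ∷ xs) with f x | foldr _xor_ false (map f xs) | count-parity f xs
... | false | _     | ih = ih
... | true  | false | ih = trans (%-distribˡ-+ 1 (sum (map (λ x → if f x then 1 else 0) xs)) 2)
                                 (cong (λ r → (1 + r) % 2) ih)
... | true  | true  | ih = trans (%-distribˡ-+ 1 (sum (map (λ x → if f x then 1 else 0) xs)) 2)
                                 (cong (λ r → (1 + r) % 2) ih)

lookup-injective : ∀ {A : Set} {xs : List A} → Unique xs →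
  ∀ {s t} → lookup xs s ≡ lookup xs t → s ≡ t
lookup-injective (_   ∷ _)  {zero}  {zero}  _ = refl
lookup-injective (x∉ ∷ _)  {zero}  {suc t} e = contradiction e (All.lookup x∉ (∈-lookup t))
lookup-injective (x∉ ∷ _)  {suc s} {zero}  e = contradiction (sym e) (All.lookup x∉ (∈-lookup s))
lookup-injective (_   ∷ u) {suc s} {suc t} e = cong suc (lookup-injective u e)

injective-from-⊎⇒≤ : ∀ {k l c} (f : Fin k ⊎ Fin l → Fin c) → Injective _≡_ _≡_ f → k + l ≤ c
injective-from-⊎⇒≤ {k} {l} f f-inj = injective⇒≤ {f = f ∘ splitAt k} λ {x} {y} e →
  trans (sym (join-splitAt k l x)) (trans (cong (join k l) (f-inj e)) (join-splitAt k l y))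

injective-into-⊎⇒≤ : ∀ {k l c} (f : Fin c → Fin k ⊎ Fin l) → Injective _≡_ _≡_ f → c ≤ k + l
injective-into-⊎⇒≤ {k} {l} f f-inj = injective⇒≤ {f = join k l ∘ f} λ {x} {y} e →
  f-inj (trans (sym (splitAt-join k l (f x))) (trans (cong (splitAt k) e) (splitAt-join k l (f y))))

module _ {n} (G : SimpleGraph n) where

  Adj-sym : ∀ {v w} → Adj G v w → Adj G w v
  Adj-sym {v} {w} e = trans (adj-sym G w v) e

  Reach-mono : ∀ {S S′ : Labeling n} → (∀ {v} → S v ≡ true → S′ v ≡ true) →
    ∀ {u v} → Reach G S u v → Reach G S′ u v
  Reach-mono S⊆S′ here         = here
  Reach-mono S⊆S′ (step r e s) = step (Reach-mono S⊆S′ r) e (S⊆S′ s)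

  -- Chain u z vs : vs ++ [ z ] is a walk whose vertex before z is u.
  data Chain (u z : Fin n) : List (Fin n) → Set where
    end  : Adj G u z → Chain u z (u ∷ [])
    _∷_  : ∀ {x y vs} → Adj G x y → Chain u z (y ∷ vs) → Chain u z (x ∷ y ∷ vs)

  Chain-linked : ∀ {u z vs} → Chain u z vs → Linked (Adj G) (vs ++ [ z ])
  Chain-linked (end e)  = e ∷ [-]
  Chain-linked (e ∷ ch) = e ∷ Chain-linked ch

  Chain-length : ∀ {u z v vs} → u ≢ v → Chain u z (v ∷ vs) → 2 ≤ length (v ∷ vs)
  Chain-length u≢v (end _) = contradiction refl u≢v
  Chain-length u≢v (_ ∷ _) = s≤s (s≤s z≤n)

  SimpleChain : Labeling n → Fin n → Fin n → Fin n → Set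
  SimpleChain S u z v = Σ (List (Fin n)) λ vs →
    Chain u z (v ∷ vs) × Unique (v ∷ vs) × All (λ x → S x ≡ true) (v ∷ vs)

  SimpleChain-suffix : ∀ {S u z v w} ((vs , _) : SimpleChain S u z v) → w ∈ v ∷ vs →
    SimpleChain S u z w
  SimpleChain-suffix c (here refl) = c
  SimpleChain-suffix (_ , (_ ∷ ch) , (_ ∷ u) , (_ ∷ s)) (there w∈) =
    SimpleChain-suffix (_ , ch , u , s) w∈
  SimpleChain-suffix (_ , end _ , _ , _) (there ())

  -- Loop erasure: on revisiting a vertex, cut the chain back to it.
  Reach⇒SimpleChain : ∀ {S u v z} → Adj G u z → S u ≡ true → Reach G S u v → SimpleChain S u z v
  Reach⇒SimpleChain e Su here = [] , end e , ([] ∷ []) , (Su ∷ [])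
  Reach⇒SimpleChain e Su (step {v = v} {w = w} r e′ Sw)
    with Reach⇒SimpleChain e Su r
  ... | c@(vs , ch , u , s) with any? (w ≟_) (v ∷ vs)
  ...   | yes w∈ = SimpleChain-suffix c w∈
  ...   | no  w∉ = v ∷ vs , (Adj-sym e′ ∷ ch) , (¬Any⇒All¬ _ w∉ ∷ u) , (Sw ∷ s)

  Acyclic⇒neighbours-separated : Acyclic G → ∀ {S i j j′} → S i ≡ false → S j ≡ true →
    Adj G i j → Adj G i j′ → Reach G S j j′ → j ≡ j′
  Acyclic⇒neighbours-separated acyclic {S} {i} {j} {j′} Si Sj i~j i~j′ r with j ≟ j′
  ... | yes j≡j′ = j≡j′
  ... | no  j≢j′ = ⊥-elim (cycle (Reach⇒SimpleChain (Adj-sym i~j) Sj r))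
    where
    cycle : SimpleChain S j i j′ → ⊥
    cycle (vs , ch , u , s) =
      acyclic (i ∷ j′ ∷ vs) (Chain-length j≢j′ ch , (All.map i≢ s ∷ u) , (i~j′ ∷ Chain-linked ch))
      where
      i≢ : ∀ {x} → S x ≡ true → i ≢ x
      i≢ Sx refl = contradiction (trans (sym Si) Sx) λ ()

components-≤ : ∀ {n} {G : SimpleGraph n} {a a′ : Labeling n} {c c′ : ℕ} →
  (∀ v → a v ≡ a′ v) → HasComponents G a c → HasComponents G a′ c′ → c ≤ c′
components-≤ {G = G} {a} {a′} a≗a′ H H′ = injective⇒≤ {f = φ} φ-injective
  where
  module H  = HasComponents H
  module H′ = HasComponents H′
  representative : Fin _ → Ones a
  representative k = proj₁ (H.surjective k)
  φ : Fin _ → Fin _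
  φ k = let (v , av) = representative k in H′.comp (v , trans (sym (a≗a′ v)) av)
  φ-injective : Injective _≡_ _≡_ φ
  φ-injective {k} {l} e = begin
    k                               ≡⟨ proj₂ (H.surjective k) ⟨
    H.comp (representative k)       ≡⟨ H.sameComp← _ _ (Reach-mono G (λ {v} → trans (a≗a′ v))
                                                         (H′.sameComp→ _ _ e)) ⟩
    H.comp (representative l)       ≡⟨ proj₂ (H.surjective l) ⟩
    l                               ∎
    where open ≡-Reasoning

components-unique : ∀ {n} {G : SimpleGraph n} {a a′ : Labeling n} {c c′ : ℕ} →
  (∀ v → a v ≡ a′ v) → HasComponents G a c → HasComponents G a′ c′ → c ≡ c′
components-unique a≗a′ H H′ = ≤-antisym (components-≤ a≗a′ H H′) (components-≤ (sym ∘ a≗a′) H′ H)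

module AddVertex {n} (G : SimpleGraph n) (acyclic : Acyclic G) (i : Fin n) (a b : Labeling n)
  (aᵢ : a i ≡ false) (bᵢ : b i ≡ true) (a≗b : ∀ {j} → j ≢ i → a j ≡ b j)
  {ca cb : ℕ} (HA : HasComponents G a ca) (HB : HasComponents G b cb) where

  module A = HasComponents HA
  module B = HasComponents HB

  a⇒≢i : ∀ {v} → a v ≡ true → v ≢ i
  a⇒≢i av refl = contradiction (trans (sym aᵢ) av) λ ()

  a⇒b : ∀ {v} → a v ≡ true → b v ≡ true
  a⇒b av = trans (sym (a≗b (a⇒≢i av))) av

  b⇒a : ∀ {v} → v ≢ i → b v ≡ true → a v ≡ true
  b⇒a v≢i bv = trans (a≗b v≢i) bv

  toB : Ones a → Ones b
  toB (v , av) = v , a⇒b av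

  Kᵢ : Fin cb
  Kᵢ = B.comp (i , bᵢ)

  B-comp-irrelevant : ∀ {v} (p q : b v ≡ true) → B.comp (v , p) ≡ B.comp (v , q)
  B-comp-irrelevant p q = B.sameComp← (_ , p) (_ , q) here

  ≢Kᵢ⇒≢i : ((v , bv) : Ones b) → B.comp (v , bv) ≢ Kᵢ → v ≢ i
  ≢Kᵢ⇒≢i (v , bv) ≢Kᵢ refl = ≢Kᵢ (B-comp-irrelevant bv bᵢ)

  B⇒A-outside-Kᵢ : ∀ x → B.comp x ≢ Kᵢ → ∀ {w} → Reach G b (proj₁ x) w → Reach G a (proj₁ x) w
  B⇒A-outside-Kᵢ x ≢Kᵢ here = here
  B⇒A-outside-Kᵢ x ≢Kᵢ (step r e bw) = step (B⇒A-outside-Kᵢ x ≢Kᵢ r) e (b⇒a w≢i bw)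
    where
    w≢i = ≢Kᵢ⇒≢i (_ , bw) λ w∈Kᵢ → ≢Kᵢ (trans (B.sameComp← x (_ , bw) (step r e bw)) w∈Kᵢ)

  labelledNeighbour : Fin n → Bool
  labelledNeighbour k = adj G i k ∧ a k

  -- The last departure from i of a b-walk starting at i leads through a labelled neighbour.
  Reach-from-i : ∀ {w} → Reach G b i w → w ≢ i →
    Σ (Fin n) λ j → labelledNeighbour j ≡ true × Reach G a j w
  Reach-from-i here w≢i = contradiction refl w≢i
  Reach-from-i (step {v = v} {w = w} r e bw) w≢i with v ≟ i
  ... | yes refl = w , to T-≡ (from T-∧ (from T-≡ e , from T-≡ (b⇒a w≢i bw))) , here
  ... | no  v≢i  = let (j , j-nb , rj) = Reach-from-i r v≢i in j , j-nb , step rj e (b⇒a w≢i bw)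

  neighbours : List (Fin n)
  neighbours = filterᵇ labelledNeighbour (allFin n)

  m : ℕ
  m = length neighbours

  neighbour-labelled : (t : Fin m) → IsTrue (labelledNeighbour (lookup neighbours t))
  neighbour-labelled t = All.lookup (all-filter (T? ∘ labelledNeighbour) (allFin n)) (∈-lookup t)

  neighbour : Fin m → Ones a
  neighbour t = lookup neighbours t , to T-≡ (proj₂ (to T-∧ (neighbour-labelled t)))

  i~neighbour : (t : Fin m) → Adj G i (proj₁ (neighbour t))
  i~neighbour t = to T-≡ (proj₁ (to T-∧ (neighbour-labelled t)))

  neighbour-in-Kᵢ : ∀ t → B.comp (toB (neighbour t)) ≡ Kᵢ
  neighbour-in-Kᵢ t = B.sameComp← _ _ (step here (Adj-sym G (i~neighbour t)) bᵢ)

  neighbour-index : ∀ j → labelledNeighbour j ≡ true → Σ (Fin m) λ t → proj₁ (neighbour t) ≡ j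
  neighbour-index j j-nb = index j∈ , sym (lookup-index j∈)
    where j∈ = ∈-filter⁺ (T? ∘ labelledNeighbour) (∈-allFin j) (from T-≡ j-nb)

  Kᵢ⇒neighbour : ∀ x → B.comp (toB x) ≡ Kᵢ → Σ (Fin m) λ t → A.comp (neighbour t) ≡ A.comp x
  Kᵢ⇒neighbour x@(v , av) x∈Kᵢ =
    let (j , j-nb , rj) = Reach-from-i (B.sameComp→ (i , bᵢ) (toB x) (sym x∈Kᵢ)) (a⇒≢i av)
        (t , t↦j)      = neighbour-index j j-nb
    in t , A.sameComp← _ x (subst (λ u → Reach G a u v) (sym t↦j) rj)

  neighbour-comp-injective : ∀ {t t′} → A.comp (neighbour t) ≡ A.comp (neighbour t′) → t ≡ t′
  neighbour-comp-injective {t} {t′} e = lookup-injective (filter⁺ _ (allFin⁺ n))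
    (Acyclic⇒neighbours-separated G acyclic aᵢ (proj₂ (neighbour t)) (i~neighbour t) (i~neighbour t′)
      (A.sameComp→ _ _ e))

  A⇒B : ∀ x y → A.comp x ≡ A.comp y → B.comp (toB x) ≡ B.comp (toB y)
  A⇒B x y e = B.sameComp← (toB x) (toB y) (Reach-mono G a⇒b (A.sameComp→ x y e))

  representativeB : (k : Fin cb) → k ≢ Kᵢ → Ones a
  representativeB k k≢Kᵢ = v , b⇒a (≢Kᵢ⇒≢i (v , bv) λ e → k≢Kᵢ (trans (sym v∈k) e)) bv
    where
    v   = proj₁ (proj₁ (B.surjective k))
    bv  = proj₂ (proj₁ (B.surjective k))
    v∈k = proj₂ (B.surjective k)

  representativeB-comp : ∀ k k≢Kᵢ → B.comp (toB (representativeB k k≢Kᵢ)) ≡ k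
  representativeB-comp k k≢Kᵢ = trans (B-comp-irrelevant _ _) (proj₂ (B.surjective k))

  fromB : (k : Fin cb) → Dec (k ≡ Kᵢ) → Fin (suc ca)
  fromB k (yes _)    = zero
  fromB k (no k≢Kᵢ) = suc (A.comp (representativeB k k≢Kᵢ))

  fromNeighbour : Fin m → Fin (suc ca)
  fromNeighbour t = suc (A.comp (neighbour t))

  fromB-injective : ∀ k k′ d d′ → fromB k d ≡ fromB k′ d′ → k ≡ k′
  fromB-injective k k′ (yes k≡Kᵢ) (yes k′≡Kᵢ) _ = trans k≡Kᵢ (sym k′≡Kᵢ)
  fromB-injective k k′ (no k≢Kᵢ)  (no k′≢Kᵢ)  e =
    trans (sym (representativeB-comp k k≢Kᵢ))
          (trans (A⇒B _ _ (Fin.suc-injective e)) (representativeB-comp k′ k′≢Kᵢ))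

  fromB≢fromNeighbour : ∀ k d t → fromB k d ≢ fromNeighbour t
  fromB≢fromNeighbour k (no k≢Kᵢ) t e = k≢Kᵢ
    (trans (sym (representativeB-comp k k≢Kᵢ)) (trans (A⇒B _ _ (Fin.suc-injective e)) (neighbour-in-Kᵢ t)))

  into-A : Fin cb ⊎ Fin m → Fin (suc ca)
  into-A (inj₁ k) = fromB k (k ≟ Kᵢ)
  into-A (inj₂ t) = fromNeighbour t

  into-A-injective : Injective _≡_ _≡_ into-A
  into-A-injective {inj₁ k} {inj₁ k′} e = cong inj₁ (fromB-injective k k′ (k ≟ Kᵢ) (k′ ≟ Kᵢ) e)
  into-A-injective {inj₁ k} {inj₂ t}  e = contradiction e (fromB≢fromNeighbour k (k ≟ Kᵢ) t)
  into-A-injective {inj₂ t} {inj₁ k}  e = contradiction (sym e) (fromB≢fromNeighbour k (k ≟ Kᵢ) t)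
  into-A-injective {inj₂ t} {inj₂ t′} e = cong inj₂ (neighbour-comp-injective (Fin.suc-injective e))

  representativeA : Fin ca → Ones a
  representativeA k = proj₁ (A.surjective k)

  fromA : ∀ x → Dec (B.comp (toB x) ≡ Kᵢ) → Fin cb ⊎ Fin m
  fromA x (yes x∈Kᵢ) = inj₂ (proj₁ (Kᵢ⇒neighbour x x∈Kᵢ))
  fromA x (no  _)    = inj₁ (B.comp (toB x))

  fromA-injective : ∀ x y d d′ → fromA x d ≡ fromA y d′ → A.comp x ≡ A.comp y
  fromA-injective x y (yes x∈Kᵢ) (yes y∈Kᵢ) e =
    trans (sym (proj₂ (Kᵢ⇒neighbour x x∈Kᵢ)))
          (trans (cong (A.comp ∘ neighbour) (inj₂-injective e)) (proj₂ (Kᵢ⇒neighbour y y∈Kᵢ)))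
  fromA-injective x y (no x∉Kᵢ) (no _) e =
    A.sameComp← x y (B⇒A-outside-Kᵢ (toB x) x∉Kᵢ (B.sameComp→ (toB x) (toB y) (inj₁-injective e)))

  fromA≢Kᵢ : ∀ x d → fromA x d ≢ inj₁ Kᵢ
  fromA≢Kᵢ x (no x∉Kᵢ) e = x∉Kᵢ (inj₁-injective e)

  into-B : Fin (suc ca) → Fin cb ⊎ Fin m
  into-B zero    = inj₁ Kᵢ
  into-B (suc k) = fromA x (B.comp (toB x) ≟ Kᵢ) where x = representativeA k

  into-B-injective : Injective _≡_ _≡_ into-B
  into-B-injective {zero}  {zero}   _ = refl
  into-B-injective {zero}  {suc k}  e = contradiction (sym e) (fromA≢Kᵢ _ _)
  into-B-injective {suc k} {zero}   e = contradiction e (fromA≢Kᵢ _ _)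
  into-B-injective {suc k} {suc k′} e = cong suc (begin
    k                           ≡⟨ proj₂ (A.surjective k) ⟨
    A.comp (representativeA k)  ≡⟨ fromA-injective _ _ (_ ≟ Kᵢ) (_ ≟ Kᵢ) e ⟩
    A.comp (representativeA k′) ≡⟨ proj₂ (A.surjective k′) ⟩
    k′                          ∎)
    where open ≡-Reasoning

  components : suc ca ≡ cb + numOnesNbrs G a i
  components = trans (≤-antisym (injective-into-⊎⇒≤ into-B into-B-injective)
                                (injective-from-⊎⇒≤ into-A into-A-injective))
                     (cong (cb +_) (sym (count-filterᵇ labelledNeighbour (allFin n))))

module _ {n} (G : SimpleGraph n) (i : Fin n) (a : Labeling n) where

  T-elsewhere : ∀ {j} → j ≢ i → T G i a j ≡ a j
  T-elsewhere {j} j≢i with j ≟ i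
  ... | yes j≡i = contradiction j≡i j≢i
  ... | no  _   = refl

  T-at : T G i a i ≡ a i xor neighbourSum G a i
  T-at with i ≟ i
  ... | yes _   = refl
  ... | no  i≢i = contradiction refl i≢i

  numOnesNbrs-parity : numOnesNbrs G a i % 2 ≡ (if neighbourSum G a i then 1 else 0)
  numOnesNbrs-parity = count-parity (λ k → adj G i k ∧ a k) (allFin n)

  neighbourSum-even : numOnesNbrs G a i % 2 ≡ 0 → neighbourSum G a i ≡ false
  neighbourSum-even even with neighbourSum G a i | numOnesNbrs-parity
  ... | false | _   = refl
  ... | true  | par = contradiction (trans (sym par) even) λ ()

  neighbourSum-odd : numOnesNbrs G a i % 2 ≡ 1 → neighbourSum G a i ≡ true
  neighbourSum-odd odd with neighbourSum G a i | numOnesNbrs-parity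
  ... | true  | _   = refl
  ... | false | par = contradiction (trans (sym par) odd) λ ()

  T-even : numOnesNbrs G a i % 2 ≡ 0 → ∀ j → T G i a j ≡ a j
  T-even even j with j ≟ i
  ... | yes refl = trans (cong (a i xor_) (neighbourSum-even even)) (xor-identityʳ (a i))
  ... | no  _    = refl

  T-odd : numOnesNbrs G a i % 2 ≡ 1 → T G i a i ≡ not (a i)
  T-odd odd = begin
    T G i a i                    ≡⟨ T-at ⟩
    a i xor neighbourSum G a i   ≡⟨ cong (a i xor_) (neighbourSum-odd odd) ⟩
    a i xor true                 ≡⟨ xor-comm (a i) true ⟩
    true xor a i                 ≡⟨ true-xor (a i) ⟩
    not (a i)                    ∎
    where open ≡-Reasoning

  numOnesNbrs-local : ∀ {a′ : Labeling n} → (∀ {j} → j ≢ i → a j ≡ a′ j) →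
    numOnesNbrs G a i ≡ numOnesNbrs G a′ i
  numOnesNbrs-local {a′} a≗a′ = cong sum (map-cong same-indicator (allFin n))
    where
    same-indicator : ∀ k → (if adj G i k ∧ a k then 1 else 0) ≡ (if adj G i k ∧ a′ k then 1 else 0)
    same-indicator k with k ≟ i
    ... | yes refl rewrite irrefl G k = refl
    ... | no  k≢i  rewrite a≗a′ k≢i   = refl

%2-cases : ∀ k → k % 2 ≡ 0 ⊎ k % 2 ≡ 1
%2-cases k with k % 2 | m%n<n k 2
... | 0           | _               = inj₁ refl
... | 1           | _               = inj₂ refl
... | suc (suc _) | s≤s (s≤s ())

odd-cancel-suc : ∀ {x} y m → m % 2 ≡ 1 → suc x ≡ y + m → x ≡ y + (m ∸ 1)
odd-cancel-suc y (suc m) _ e = suc-injective (trans e (+-suc y m))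

+-odd∸1-parity : ∀ x m → m % 2 ≡ 1 → (x + (m ∸ 1)) % 2 ≡ x % 2
+-odd∸1-parity x m odd = begin
  (x + (m ∸ 1)) % 2                   ≡⟨ cong (λ k → (x + (k ∸ 1)) % 2) (m≡m%n+[m/n]*n m 2) ⟩
  (x + (m % 2 + (m / 2) * 2 ∸ 1)) % 2 ≡⟨ cong (λ r → (x + (r + (m / 2) * 2 ∸ 1)) % 2) odd ⟩
  (x + (m / 2) * 2) % 2               ≡⟨ [m+kn]%n≡m%n x (m / 2) 2 ⟩
  x % 2                               ∎
  where open ≡-Reasoning

components-T-odd : ∀ {n} (G : SimpleGraph n) → Acyclic G → ∀ i a {c c′} →
  numOnesNbrs G a i % 2 ≡ 1 → HasComponents G a c → HasComponents G (T G i a) c′ →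
  (c′ ≡ c + (numOnesNbrs G a i ∸ 1)) ⊎ (c ≡ c′ + (numOnesNbrs G a i ∸ 1))
components-T-odd G acyclic i a {c} {c′} odd HA HT with a i Bool.≟ true
... | no  aᵢ≢true = inj₂ (odd-cancel-suc c′ _ odd
  (AddVertex.components G acyclic i a (T G i a) aᵢ Tᵢ (sym ∘ T-elsewhere G i a) HA HT))
  where
  aᵢ = ¬-not aᵢ≢true
  Tᵢ = trans (T-odd G i a odd) (cong not aᵢ)
... | yes aᵢ = inj₁ (odd-cancel-suc c _ odd (begin
  suc c′                        ≡⟨ AddVertex.components G acyclic i (T G i a) a Tᵢ aᵢ (T-elsewhere G i a) HT HA ⟩
  c + numOnesNbrs G (T G i a) i ≡⟨ cong (c +_) (numOnesNbrs-local G i (T G i a) (T-elsewhere G i a)) ⟩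
  c + numOnesNbrs G a i         ∎))
  where
  open ≡-Reasoning
  Tᵢ = trans (T-odd G i a odd) (cong not aᵢ)

proposition3p11 : ∀ {n : ℕ} (G : SimpleGraph n) → IsTree G →
    (i : Fin n) (a : Labeling n) (c c′ : ℕ) →
    HasComponents G a c → HasComponents G (T G i a) c′ →
    ((numOnesNbrs G a i % 2 ≡ 0 → c′ ≡ c)
     × (numOnesNbrs G a i % 2 ≡ 1 →
          (c′ ≡ c + (numOnesNbrs G a i ∸ 1)) ⊎ (c ≡ c′ + (numOnesNbrs G a i ∸ 1)))
     × (c′ % 2 ≡ c % 2))
proposition3p11 G (_ , acyclic) i a c c′ HA HT = even , odd , parity
  where
  even : numOnesNbrs G a i % 2 ≡ 0 → c′ ≡ c
  even m-even = components-unique (T-even G i a m-even) HT HA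

  odd : numOnesNbrs G a i % 2 ≡ 1 →
        (c′ ≡ c + (numOnesNbrs G a i ∸ 1)) ⊎ (c ≡ c′ + (numOnesNbrs G a i ∸ 1))
  odd m-odd = components-T-odd G acyclic i a m-odd HA HT

  parity : c′ % 2 ≡ c % 2
  parity with %2-cases (numOnesNbrs G a i)
  ... | inj₁ m-even = cong (_% 2) (even m-even)
  ... | inj₂ m-odd with odd m-odd
  ...   | inj₁ c′≡ = trans (cong (_% 2) c′≡) (+-odd∸1-parity c (numOnesNbrs G a i) m-odd)
  ...   | inj₂ c≡  = sym (trans (cong (_% 2) c≡) (+-odd∸1-parity c′ (numOnesNbrs G a i) m-odd))
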